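{- Let $n\geq 1$ and $0\leq k\leq\lfloor (n-1)/2\rfloor$. Let $H_k$ be the graph on vertex set $\{u_1,\dots,u_n,v_1,\dots,v_n\}$ whose edges are: $u_iv_i$ for $1\leq i\leq n$; $u_{2i-1}u_{2i}$ and $v_{2i-1}v_{2i}$ for $1\leq i\leq k$; and $u_iv_j$ for all ordered pairs $i\neq j$ with $\{i,j\}\neq\{2t-1,2t\}$ for every $1\leq t\leq k$. Then $f(H_k)=n-k-1$.
   Context: For a perfect matching $M$ of a graph $G$, a forcing set of $M$ is a subset of $M$ contained in no other perfect matching of $G$; $f(G,M)$ is its smallest cardinality, and $f(G)$ is the minimum of $f(G,M)$ over all perfect matchings $M$ of $G$. (In the paper, $H_k$ is described as the minimal graph of order $2n$ with a perfect matching $M_0=\{u_iv_i\}$ such that $f(H_k,M_0)=n-1$ and $H_k[\{u_1,\dots,u_n\}]$ has exactly the $k$ edges $u_{2i-1}u_{2i}$, $1\le i\le k$; this determines exactly the graph described in the claim.) -}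

module Defs where

open import Data.Nat using (ℕ; _+_; _*_; _<_; _≤_)
open import Data.Fin using (Fin; toℕ; splitAt)
open import Data.Fin.Subset using (Subset; _∈_; ∣_∣)
open import Data.Sum using (_⊎_; inj₁; inj₂)
open import Data.Product using (Σ; _×_; ∃)
open import Relation.Binary.PropositionalEquality using (_≡_; _≢_)
open import Relation.Nullary using (¬_)

Graph : ℕ → Set₁
Graph N = Fin N → Fin N → Set

-- Two perfect matchings are the same edge set iff their mate maps agree pointwise.
record PerfectMatching {N : ℕ} (G : Graph N) : Set where
  field
    mate       : Fin N → Fin N
    mate-adj   : ∀ x → G x (mate x)
    mate-irr   : ∀ x → mate x ≢ x
    mate-invol : ∀ x → mate (mate x) ≡ x
open PerfectMatching public

-- A subset S of the edges of M, represented by the set of endpoints of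
-- its edges (a vertex set closed under the mate map of M).
-- Its number of edges c satisfies  ∣ S ∣ ≡ 2 * c.
IsEdgeSubsetOf : ∀ {N} {G : Graph N} → Subset N → PerfectMatching G → Set
IsEdgeSubsetOf S M = ∀ x → x ∈ S → mate M x ∈ S

ContainedIn : ∀ {N} {G : Graph N} → Subset N → PerfectMatching G → PerfectMatching G → Set
ContainedIn S M M' = ∀ x → x ∈ S → mate M' x ≡ mate M x

IsForcingSet : ∀ {N} {G : Graph N} → PerfectMatching G → Subset N → Set
IsForcingSet {G = G} M S =
  IsEdgeSubsetOf S M ×
  ((M' : PerfectMatching G) → ContainedIn S M M' → ∀ x → mate M' x ≡ mate M x)

ForcingNumberIs : ∀ {N} → Graph N → ℕ → Set
ForcingNumberIs {N} G c =
  (Σ (PerfectMatching G) λ M → Σ (Subset N) λ S → IsForcingSet M S × ∣ S ∣ ≡ 2 * c)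
  × ((M : PerfectMatching G) (S : Subset N) → IsForcingSet M S → 2 * c ≤ ∣ S ∣)

-- 0-indexed: the pair {u_{2t-1}, u_{2t}} (t = 1..k) becomes indices {2t', 2t'+1}, t' < k.
Paired : ∀ {n} → ℕ → Fin n → Fin n → Set
Paired k i j = Σ ℕ λ t → t < k ×
  ((toℕ i ≡ 2 * t × toℕ j ≡ 2 * t + 1) ⊎ (toℕ i ≡ 2 * t + 1 × toℕ j ≡ 2 * t))

-- Adjacency of H_k with vertices inj₁ i = u_i, inj₂ i = v_i.
HRel : (n k : ℕ) → Fin n ⊎ Fin n → Fin n ⊎ Fin n → Set
HRel n k (inj₁ i) (inj₁ j) = Paired k i j
HRel n k (inj₂ i) (inj₂ j) = Paired k i j
HRel n k (inj₁ i) (inj₂ j) = (i ≡ j) ⊎ (i ≢ j × ¬ Paired k i j)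
HRel n k (inj₂ j) (inj₁ i) = (i ≡ j) ⊎ (i ≢ j × ¬ Paired k i j)

-- H_k on Fin (n + n): vertex x < n is u_x, vertex n + i is v_i.
H : (n k : ℕ) → Graph (n + n)
H n k x y = HRel n k (splitAt n x) (splitAt n y)

-- Indices start at 0. Upper bound: the perfect matching M₀ that matches each block {2t, 2t+1},
-- t < k, inside the u-side and inside the v-side and matches u_i to v_i otherwise is forced by its
-- k u-blocks together with all its u_i v_i edges but the last one, u_{n-1} v_{n-1}: the vertex
-- v_{n-1} is then adjacent only to u_{n-1} among the uncovered vertices, and afterwards each
-- remaining v_i only to its partner.
--
-- Lower bound: the vertices C not covered by a forcing set S of M are closed under M and span no
-- M-alternating 4-cycle, since exchanging its two M-edges would give another perfect matching
-- containing S. An M-edge inside the u-side and one inside the v-side always span such a cycle, so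
-- all M-edges in C touch one side, say the u-side. Two u–v edges of M in C avoid a cycle only if
-- the u-end of one is the block partner of the v-end of the other; this relation has in- and
-- out-degree at most one, so there are at most three such edges, and they can be given pairwise
-- distinct blocks among the k + 1 blocks not used by the u–u edges. Hence C has at most k + 1
-- edges and |S| ≥ 2(n - k - 1).

module Submission where

open import Data.Bool using (Bool; true; false; not)
open import Data.Bool.Properties using (not-¬; ¬-not)
import Data.Bool.Properties as Boolₚ
open import Data.Empty using (⊥; ⊥-elim)
open import Data.Fin as Fin using (Fin; toℕ; splitAt; join)
import Data.Fin.Properties as Finₚ
open import Data.Fin.Subset using (Subset; _∈_; ∣_∣; ∁; inside; outside) renaming (⊥ to ∅)
open import Data.Fin.Subset.Properties
  using (x∈∁p⇒x∉p; x∉p⇒x∈∁p; ∣∁p∣≡n∸∣p∣; x∈p∧x≢y⇒x∈p-y; x∈p⇒∣p-x∣<∣p∣; ∣⊤∣≡n; ∣⊥∣≡0; Empty-unique; ∈⊤)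
import Data.Fin.Subset.Properties as Subsetₚ
open import Data.List using (List; []; _∷_; filter; allFin)
open import Data.List.Membership.Propositional using () renaming (_∈_ to _∈ₗ_)
open import Data.List.Membership.Propositional.Properties using (∈-filter⁺; ∈-filter⁻; ∈-allFin)
open import Data.List.Relation.Unary.All using ([]; _∷_)
open import Data.List.Relation.Unary.AllPairs using (_∷_)
open import Data.List.Relation.Unary.Any using (here; there)
open import Data.List.Relation.Unary.Unique.Propositional using (Unique)
import Data.List.Relation.Unary.Unique.Propositional.Properties as Uniqueₚ
open import Data.Maybe using (Maybe; just; nothing)
import Data.Maybe.Properties as Maybeₚ
open import Data.Nat
open import Data.Nat.DivMod using (_mod_; m<n⇒m%n≡m; m/n*n≤m)
open import Data.Nat.Properties
open import Data.Product using (∃; _×_; _,_; proj₂)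
import Data.Product as Product
open import Data.Sum using (_⊎_; inj₁; inj₂; [_,_]′)
import Data.Sum as Sum
import Data.Sum.Properties as Sumₚ
open import Data.Vec using ([]; _∷_)
import Data.Vec as Vec
open import Function using (_∘_; id; case_of_)
open import Relation.Binary.PropositionalEquality
open import Relation.Nullary using (¬_; Dec; yes; no; contradiction)
open import Relation.Nullary.Decidable using (_×-dec_)

open import Defs

-- Blocks {2t, 2t+1} of natural numbers

partner : ℕ → ℕ
partner zero          = 1
partner (suc zero)    = 0
partner (suc (suc a)) = 2 + partner a

partner-involutive : ∀ a → partner (partner a) ≡ a
partner-involutive zero          = refl
partner-involutive (suc zero)    = refl
partner-involutive (suc (suc a)) = cong (2 +_) (partner-involutive a)

partner-irreflexive : ∀ a → partner a ≢ a
partner-irreflexive (suc (suc a)) eq = partner-irreflexive a (suc-injective (suc-injective eq))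

partner-< : ∀ {k a} → a < 2 * k → partner a < 2 * k
partner-< {suc k} {a} a<2k rewrite *-suc 2 k = go a a<2k
  where
  go : ∀ a → a < 2 + 2 * k → partner a < 2 + 2 * k
  go zero          _                 = s≤s (s≤s z≤n)
  go (suc zero)    _                 = s≤s z≤n
  go (suc (suc a)) (s≤s (s≤s a<2k)) = s≤s (s≤s (partner-< {k} a<2k))

partner-even : ∀ t → partner (2 * t) ≡ 2 * t + 1
partner-even zero    = refl
partner-even (suc t) = begin
  partner (2 * suc t)  ≡⟨ cong partner (*-suc 2 t) ⟩
  2 + partner (2 * t)  ≡⟨ cong (2 +_) (partner-even t) ⟩
  2 + (2 * t + 1)      ≡⟨ cong (_+ 1) (*-suc 2 t) ⟨
  2 * suc t + 1        ∎
  where open ≡-Reasoning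

partner-odd : ∀ t → partner (2 * t + 1) ≡ 2 * t
partner-odd t = trans (cong partner (sym (partner-even t))) (partner-involutive (2 * t))

even-or-odd : ∀ a → ∃ λ t → a ≡ 2 * t ⊎ a ≡ 2 * t + 1
even-or-odd zero          = 0 , inj₁ refl
even-or-odd (suc zero)    = 0 , inj₂ refl
even-or-odd (suc (suc a)) with even-or-odd a
... | t , inj₁ a≡2t   = suc t , inj₁ (trans (cong (2 +_) a≡2t) (sym (*-suc 2 t)))
... | t , inj₂ a≡2t+1 = suc t , inj₂ (trans (cong (2 +_) a≡2t+1) (cong (_+ 1) (sym (*-suc 2 t))))

⌊/2⌋-< : ∀ {k a} → a < 2 * k → ⌊ a /2⌋ < k
⌊/2⌋-< {suc k} {zero}        _   = s≤s z≤n
⌊/2⌋-< {suc k} {suc zero}    _   = s≤s z≤n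
⌊/2⌋-< {suc k} {suc (suc a)} a<2k = s≤s (⌊/2⌋-< {k} (≤-pred (≤-pred (≤-trans a<2k (≤-reflexive (*-suc 2 k))))))

same-block : ∀ a b → ⌊ a /2⌋ ≡ ⌊ b /2⌋ → b ≡ a ⊎ b ≡ partner a
same-block zero          zero          _  = inj₁ refl
same-block zero          (suc zero)    _  = inj₂ refl
same-block (suc zero)    zero          _  = inj₂ refl
same-block (suc zero)    (suc zero)    _  = inj₁ refl
same-block zero          (suc (suc b)) ()
same-block (suc zero)    (suc (suc b)) ()
same-block (suc (suc a)) zero          ()
same-block (suc (suc a)) (suc zero)    ()
same-block (suc (suc a)) (suc (suc b)) eq =
  Sum.map (cong (2 +_)) (cong (2 +_)) (same-block a b (suc-injective eq))

record Partners (k a b : ℕ) : Set where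
  constructor _,_
  field
    below       : a < 2 * k
    partner-of  : partner a ≡ b

Partners-sym : ∀ {k a b} → Partners k a b → Partners k b a
Partners-sym {k} {a} (a<2k , refl) = partner-< {k} a<2k , partner-involutive a

Partners-irreflexive : ∀ {k a} → ¬ Partners k a a
Partners-irreflexive {a = a} (_ , eq) = partner-irreflexive a eq

Partners-functional : ∀ {k a b b′} → Partners k a b → Partners k a b′ → b ≡ b′
Partners-functional (_ , refl) (_ , refl) = refl

Partners-injective : ∀ {k a a′ b} → Partners k a b → Partners k a′ b → a ≡ a′
Partners-injective p q = Partners-functional (Partners-sym p) (Partners-sym q)

Partners? : ∀ k a b → Dec (Partners k a b)
Partners? k a b with a <? 2 * k | partner a ≟ b
... | yes a<2k | yes eq = yes (a<2k , eq)
... | no  a≮2k | _      = no (a≮2k ∘ Partners.below)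
... | _        | no  neq = no (neq ∘ Partners.partner-of)

Paired⇒Partners : ∀ {n k} {i j : Fin n} → Paired k i j → Partners k (toℕ i) (toℕ j)
Paired⇒Partners (t , t<k , inj₁ (i≡2t , j≡2t+1)) rewrite i≡2t | j≡2t+1 =
  *-monoʳ-< 2 t<k , partner-even t
Paired⇒Partners (t , t<k , inj₂ (i≡2t+1 , j≡2t)) rewrite i≡2t+1 | j≡2t =
  Partners-sym (*-monoʳ-< 2 t<k , partner-even t)

Partners⇒Paired : ∀ {n k} {i j : Fin n} → Partners k (toℕ i) (toℕ j) → Paired k i j
Partners⇒Paired {i = i} (i<2k , ij) with even-or-odd (toℕ i)
... | t , inj₁ i≡2t   = t , *-cancelˡ-< 2 t _ (subst (_< _) i≡2t i<2k) ,
                        inj₁ (i≡2t , trans (sym ij) (trans (cong partner i≡2t) (partner-even t)))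
... | t , inj₂ i≡2t+1 = t , *-cancelˡ-< 2 t _ (≤-trans (m≤m+n _ 1) (subst (_< _) i≡2t+1 i<2k)) ,
                        inj₂ (i≡2t+1 , trans (sym ij) (trans (cong partner i≡2t+1) (partner-odd t)))

-- Counting subsets of Fin N

InjectiveOn : ∀ {A : Set} {N} → Subset N → (Fin N → A) → Set
InjectiveOn p g = ∀ {x y} → x ∈ p → y ∈ p → g x ≡ g y → x ≡ y

injection⇒∣p∣≤∣q∣ : ∀ {N m} (p : Subset N) {q : Subset m} (g : Fin N → Fin m) →
                    (∀ {x} → x ∈ p → g x ∈ q) → InjectiveOn p g → ∣ p ∣ ≤ ∣ q ∣
injection⇒∣p∣≤∣q∣ []            g into injective = z≤n
injection⇒∣p∣≤∣q∣ (outside ∷ p) g into injective =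
  injection⇒∣p∣≤∣q∣ p (g ∘ Fin.suc) (into ∘ Vec.there)
    (λ x∈p y∈p eq → Finₚ.suc-injective (injective (Vec.there x∈p) (Vec.there y∈p) eq))
injection⇒∣p∣≤∣q∣ (inside ∷ p)  g into injective = ≤-trans
  (s≤s (injection⇒∣p∣≤∣q∣ p (g ∘ Fin.suc)
     (λ x∈p → x∈p∧x≢y⇒x∈p-y (into (Vec.there x∈p)) (λ eq → 0≢suc (injective Vec.here (Vec.there x∈p) (sym eq))))
     (λ x∈p y∈p eq → Finₚ.suc-injective (injective (Vec.there x∈p) (Vec.there y∈p) eq))))
  (x∈p⇒∣p-x∣<∣p∣ (into Vec.here))
  where
  0≢suc : ∀ {N} {x : Fin N} → Fin.zero ≢ Fin.suc x
  0≢suc ()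

injection⇒∣p∣≤m : ∀ {N m} (p : Subset N) (g : Fin N → ℕ) →
                  (∀ {x} → x ∈ p → g x < m) → InjectiveOn p g → ∣ p ∣ ≤ m
injection⇒∣p∣≤m {N} {zero} p g bounded _ = ≤-reflexive (begin
  ∣ p ∣      ≡⟨ cong ∣_∣ (Empty-unique λ (x , x∈p) → n≮0 (bounded x∈p)) ⟩
  ∣ ∅ {N} ∣  ≡⟨ ∣⊥∣≡0 N ⟩
  0          ∎)
  where open ≡-Reasoning
injection⇒∣p∣≤m {m = suc m} p g bounded injective = subst (∣ p ∣ ≤_) (∣⊤∣≡n (suc m))
  (injection⇒∣p∣≤∣q∣ p (λ x → g x mod suc m) (λ _ → ∈⊤)
    (λ x∈p y∈p eq → injective x∈p y∈p (mod-injective (bounded x∈p) (bounded y∈p) eq)))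
  where
  open ≡-Reasoning
  mod-injective : ∀ {a b} → a < suc m → b < suc m → a mod suc m ≡ b mod suc m → a ≡ b
  mod-injective {a} {b} a<m b<m eq = begin
    a                    ≡⟨ m<n⇒m%n≡m a<m ⟨
    a % suc m            ≡⟨ Finₚ.toℕ-fromℕ< _ ⟨
    toℕ (a mod suc m)    ≡⟨ cong toℕ eq ⟩
    toℕ (b mod suc m)    ≡⟨ Finₚ.toℕ-fromℕ< _ ⟩
    b % suc m            ≡⟨ m<n⇒m%n≡m b<m ⟩
    b                    ∎

labelled-edges⇒∣p∣≤2b : ∀ {N} (mate : Fin N → Fin N) → (∀ x → mate (mate x) ≡ x) → (∀ x → mate x ≢ x) →
                        (p : Subset N) (b : ℕ) (ℓ : Fin N → ℕ) → (∀ {x} → x ∈ p → ℓ x < b) →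
                        (∀ {x y} → x ∈ p → y ∈ p → ℓ x ≡ ℓ y → y ≡ x ⊎ y ≡ mate x) →
                        ∣ p ∣ ≤ 2 * b
labelled-edges⇒∣p∣≤2b {N} mate involutive irreflexive p b ℓ bounded labels-edges =
  injection⇒∣p∣≤m p g g-bounded g-injective
  where
  g : Fin N → ℕ
  g x with toℕ x <? toℕ (mate x)
  ... | yes _ = ℓ x
  ... | no  _ = b + ℓ x

  b+b≡2b : b + b ≡ 2 * b
  b+b≡2b = cong (b +_) (sym (+-identityʳ b))

  g-bounded : ∀ {x} → x ∈ p → g x < 2 * b
  g-bounded {x} x∈p with toℕ x <? toℕ (mate x)
  ... | yes _ = ≤-trans (bounded x∈p) (≤-trans (m≤m+n b b) (≤-reflexive b+b≡2b))
  ... | no  _ = subst (b + ℓ x <_) b+b≡2b (+-monoʳ-< b (bounded x∈p))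

  g-injective : InjectiveOn p g
  g-injective {x} {y} x∈p y∈p eq with toℕ x <? toℕ (mate x) | toℕ y <? toℕ (mate y)
  ... | yes x<x′ | yes y<y′ with labels-edges x∈p y∈p eq
  ...   | inj₁ y≡x = sym y≡x
  ...   | inj₂ refl = contradiction x<x′ (<-asym (subst (λ z → toℕ (mate x) < toℕ z) (involutive x) y<y′))
  g-injective {x} {y} x∈p y∈p eq | no x≮x′ | no y≮y′ with labels-edges x∈p y∈p (+-cancelˡ-≡ b _ _ eq)
  ...   | inj₁ y≡x = sym y≡x
  ...   | inj₂ refl = contradiction (Finₚ.toℕ-injective (≤-antisym
            (≮⇒≥ (subst (λ z → toℕ (mate x) ≮ toℕ z) (involutive x) y≮y′)) (≮⇒≥ x≮x′))) (irreflexive x ∘ sym)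
  g-injective {x} {y} x∈p y∈p eq | yes _ | no _ =
    contradiction (subst (_< b) eq (bounded x∈p)) (m+n≮m b _)
  g-injective {x} {y} x∈p y∈p eq | no _ | yes _ =
    contradiction (subst (_< b) (sym eq) (bounded y∈p)) (m+n≮m b _)

interval : ∀ {n} → ℕ → ℕ → Subset n
interval {zero}  _       _       = []
interval {suc n} zero    zero    = outside ∷ interval zero zero
interval {suc n} zero    (suc b) = inside  ∷ interval zero b
interval {suc n} (suc a) zero    = outside ∷ interval a zero
interval {suc n} (suc a) (suc b) = outside ∷ interval a b

∈-interval⁻ : ∀ {n a b} {i : Fin n} → i ∈ interval a b → a ≤ toℕ i × toℕ i < b
∈-interval⁻ {suc n} {zero}  {zero}  (Vec.there i∈) with () ← proj₂ (∈-interval⁻ i∈)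
∈-interval⁻ {suc n} {zero}  {suc b} Vec.here       = z≤n , s≤s z≤n
∈-interval⁻ {suc n} {zero}  {suc b} (Vec.there i∈) = z≤n , s≤s (proj₂ (∈-interval⁻ i∈))
∈-interval⁻ {suc n} {suc a} {zero}  (Vec.there i∈) with () ← proj₂ (∈-interval⁻ i∈)
∈-interval⁻ {suc n} {suc a} {suc b} (Vec.there i∈) = Product.map s≤s s≤s (∈-interval⁻ i∈)

∈-interval⁺ : ∀ {n a b} {i : Fin n} → a ≤ toℕ i → toℕ i < b → i ∈ interval a b
∈-interval⁺ {suc n} {zero}  {suc b} {Fin.zero}  _       _         = Vec.here
∈-interval⁺ {suc n} {zero}  {suc b} {Fin.suc i} _       (s≤s i<b) = Vec.there (∈-interval⁺ z≤n i<b)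
∈-interval⁺ {suc n} {suc a} {suc b} {Fin.suc i} (s≤s a≤i) (s≤s i<b) = Vec.there (∈-interval⁺ a≤i i<b)

∣interval∣ : ∀ {n} a b → b ≤ n → ∣ interval {n} a b ∣ ≡ b ∸ a
∣interval∣ {zero}  a       zero    _         = sym (0∸n≡0 a)
∣interval∣ {suc n} zero    zero    _         = ∣interval∣ {n} zero zero z≤n
∣interval∣ {suc n} zero    (suc b) (s≤s b≤n) = cong suc (∣interval∣ zero b b≤n)
∣interval∣ {suc n} (suc a) zero    _         = trans (∣interval∣ {n} a zero z≤n) (0∸n≡0 a)
∣interval∣ {suc n} (suc a) (suc b) (s≤s b≤n) = ∣interval∣ a b b≤n

∣p++q∣ : ∀ {m n} (p : Subset m) (q : Subset n) → ∣ p Vec.++ q ∣ ≡ ∣ p ∣ + ∣ q ∣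
∣p++q∣ []            q = refl
∣p++q∣ (outside ∷ p) q = ∣p++q∣ p q
∣p++q∣ (inside  ∷ p) q = cong suc (∣p++q∣ p q)

∈-++ˡ⁻ : ∀ {m n} {p : Subset m} {q : Subset n} {i} → (i Fin.↑ˡ n) ∈ p Vec.++ q → i ∈ p
∈-++ˡ⁻ {p = _ ∷ p} {i = Fin.zero}  Vec.here        = Vec.here
∈-++ˡ⁻ {p = _ ∷ p} {i = Fin.suc i} (Vec.there i∈) = Vec.there (∈-++ˡ⁻ i∈)

∈-++ˡ⁺ : ∀ {m n} {p : Subset m} {q : Subset n} {i} → i ∈ p → (i Fin.↑ˡ n) ∈ p Vec.++ q
∈-++ˡ⁺ Vec.here        = Vec.here
∈-++ˡ⁺ (Vec.there i∈) = Vec.there (∈-++ˡ⁺ i∈)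

∈-++ʳ⁻ : ∀ {m n} {p : Subset m} {q : Subset n} {i} → (m Fin.↑ʳ i) ∈ p Vec.++ q → i ∈ q
∈-++ʳ⁻ {p = []}    i∈             = i∈
∈-++ʳ⁻ {p = _ ∷ p} (Vec.there i∈) = ∈-++ʳ⁻ {p = p} i∈

∈-++ʳ⁺ : ∀ {m n} {p : Subset m} {q : Subset n} {i} → i ∈ q → (m Fin.↑ʳ i) ∈ p Vec.++ q
∈-++ʳ⁺ {p = []}    i∈ = i∈
∈-++ʳ⁺ {p = _ ∷ p} i∈ = Vec.there (∈-++ʳ⁺ {p = p} i∈)

-- Alternating cycles and forcing sets

mate-injective : ∀ {N} {G : Graph N} (M : PerfectMatching G) {a b} → mate M a ≡ mate M b → a ≡ b
mate-injective M {a} {b} eq = trans (sym (mate-invol M a)) (trans (cong (mate M) eq) (mate-invol M b))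

record AlternatingCycle {N} {G : Graph N} (M : PerfectMatching G) (C : Subset N) : Set where
  field
    {x y}     : Fin N
    x∈C       : x ∈ C
    y∈C       : y ∈ C
    y≢x       : y ≢ x
    y≢mate-x  : y ≢ mate M x
    edge      : G x y
    mate-edge : G (mate M x) (mate M y)

module Rotation {N} {G : Graph N} (G-sym : ∀ {a b} → G a b → G b a) (M : PerfectMatching G)
  {x y : Fin N} (y≢x : y ≢ x) (y≢x′ : y ≢ mate M x) (xy : G x y) (x′y′ : G (mate M x) (mate M y)) where

  private
    m : Fin N → Fin N
    m = mate M
    x′ y′ : Fin N
    x′ = m x
    y′ = m y

    x≢x′ : x ≢ x′
    x≢x′ = mate-irr M x ∘ sym
    y≢y′ : y ≢ y′
    y≢y′ = mate-irr M y ∘ sym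
    x≢y′ : x ≢ y′
    x≢y′ x≡y′ = y≢x′ (trans (sym (mate-invol M y)) (cong m (sym x≡y′)))
    x′≢y′ : x′ ≢ y′
    x′≢y′ = y≢x ∘ sym ∘ mate-injective M

  rotate : Fin N → Fin N
  rotate z with z Finₚ.≟ x | z Finₚ.≟ y | z Finₚ.≟ x′ | z Finₚ.≟ y′
  ... | yes _ | _     | _     | _     = y
  ... | no _  | yes _ | _     | _     = x
  ... | no _  | no _  | yes _ | _     = y′
  ... | no _  | no _  | no _  | yes _ = x′
  ... | no _  | no _  | no _  | no _  = m z

  rotate-x : rotate x ≡ y
  rotate-x with x Finₚ.≟ x | x Finₚ.≟ y | x Finₚ.≟ x′ | x Finₚ.≟ y′
  ... | yes _   | _ | _ | _ = refl
  ... | no x≢x  | _ | _ | _ = contradiction refl x≢x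

  rotate-y : rotate y ≡ x
  rotate-y with y Finₚ.≟ x | y Finₚ.≟ y | y Finₚ.≟ x′ | y Finₚ.≟ y′
  ... | yes y≡x | _       | _ | _ = contradiction y≡x y≢x
  ... | no _    | yes _   | _ | _ = refl
  ... | no _    | no y≢y  | _ | _ = contradiction refl y≢y

  rotate-x′ : rotate x′ ≡ y′
  rotate-x′ with x′ Finₚ.≟ x | x′ Finₚ.≟ y | x′ Finₚ.≟ x′ | x′ Finₚ.≟ y′
  ... | yes x′≡x | _        | _        | _ = contradiction (sym x′≡x) x≢x′
  ... | no _     | yes x′≡y | _        | _ = contradiction (sym x′≡y) y≢x′
  ... | no _     | no _     | yes _    | _ = refl
  ... | no _     | no _     | no x′≢x′ | _ = contradiction refl x′≢x′

  rotate-y′ : rotate y′ ≡ x′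
  rotate-y′ with y′ Finₚ.≟ x | y′ Finₚ.≟ y | y′ Finₚ.≟ x′ | y′ Finₚ.≟ y′
  ... | yes y′≡x | _        | _        | _        = contradiction (sym y′≡x) x≢y′
  ... | no _     | yes y′≡y | _        | _        = contradiction (sym y′≡y) y≢y′
  ... | no _     | no _     | yes y′≡x′ | _       = contradiction (sym y′≡x′) x′≢y′
  ... | no _     | no _     | no _     | yes _    = refl
  ... | no _     | no _     | no _     | no y′≢y′ = contradiction refl y′≢y′

  rotate-elsewhere : ∀ {z} → z ≢ x → z ≢ y → z ≢ x′ → z ≢ y′ → rotate z ≡ m z
  rotate-elsewhere {z} z≢x z≢y z≢x′ z≢y′ with z Finₚ.≟ x | z Finₚ.≟ y | z Finₚ.≟ x′ | z Finₚ.≟ y′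
  ... | yes z≡x | _       | _        | _        = contradiction z≡x z≢x
  ... | no _    | yes z≡y | _        | _        = contradiction z≡y z≢y
  ... | no _    | no _    | yes z≡x′ | _        = contradiction z≡x′ z≢x′
  ... | no _    | no _    | no _     | yes z≡y′ = contradiction z≡y′ z≢y′
  ... | no _    | no _    | no _     | no _     = refl

  private
    data Position : Fin N → Set where
      is-x      : Position x
      is-y      : Position y
      is-x′     : Position x′
      is-y′     : Position y′
      elsewhere : ∀ {z} → z ≢ x → z ≢ y → z ≢ x′ → z ≢ y′ → Position z

    position : ∀ z → Position z
    position z with z Finₚ.≟ x | z Finₚ.≟ y | z Finₚ.≟ x′ | z Finₚ.≟ y′
    ... | yes refl | _        | _        | _        = is-x
    ... | no _     | yes refl | _        | _        = is-y
    ... | no _     | no _     | yes refl | _        = is-x′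
    ... | no _     | no _     | no _     | yes refl = is-y′
    ... | no z≢x   | no z≢y   | no z≢x′  | no z≢y′  = elsewhere z≢x z≢y z≢x′ z≢y′

  rotate-adjacent : ∀ z → G z (rotate z)
  rotate-adjacent z with position z
  ... | is-x  = subst (G x) (sym rotate-x) xy
  ... | is-y  = subst (G y) (sym rotate-y) (G-sym xy)
  ... | is-x′ = subst (G x′) (sym rotate-x′) x′y′
  ... | is-y′ = subst (G y′) (sym rotate-y′) (G-sym x′y′)
  ... | elsewhere z≢x z≢y z≢x′ z≢y′ = subst (G z) (sym (rotate-elsewhere z≢x z≢y z≢x′ z≢y′)) (mate-adj M z)

  rotate-irreflexive : ∀ z → rotate z ≢ z
  rotate-irreflexive z with position z
  ... | is-x  = λ eq → y≢x (trans (sym rotate-x) eq)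
  ... | is-y  = λ eq → y≢x (sym (trans (sym rotate-y) eq))
  ... | is-x′ = λ eq → x′≢y′ (sym (trans (sym rotate-x′) eq))
  ... | is-y′ = λ eq → x′≢y′ (trans (sym rotate-y′) eq)
  ... | elsewhere z≢x z≢y z≢x′ z≢y′ = mate-irr M z ∘ trans (sym (rotate-elsewhere z≢x z≢y z≢x′ z≢y′))

  rotate-involutive : ∀ z → rotate (rotate z) ≡ z
  rotate-involutive z with position z
  ... | is-x  = trans (cong rotate rotate-x) rotate-y
  ... | is-y  = trans (cong rotate rotate-y) rotate-x
  ... | is-x′ = trans (cong rotate rotate-x′) rotate-y′
  ... | is-y′ = trans (cong rotate rotate-y′) rotate-x′
  ... | elsewhere z≢x z≢y z≢x′ z≢y′ = begin
    rotate (rotate z) ≡⟨ cong rotate (rotate-elsewhere z≢x z≢y z≢x′ z≢y′) ⟩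
    rotate (m z)      ≡⟨ rotate-elsewhere (z≢x′ ∘ m-swap) (z≢y′ ∘ m-swap) (z≢x ∘ mate-injective M) (z≢y ∘ mate-injective M) ⟩
    m (m z)           ≡⟨ mate-invol M z ⟩
    z                 ∎
    where
    open ≡-Reasoning
    m-swap : ∀ {a} → m z ≡ a → z ≡ m a
    m-swap {a} refl = sym (mate-invol M z)

  rotated : PerfectMatching G
  rotated = record
    { mate = rotate ; mate-adj = rotate-adjacent ; mate-irr = rotate-irreflexive ; mate-invol = rotate-involutive }

complement-closed : ∀ {N} {G : Graph N} {M : PerfectMatching G} {S : Subset N} →
                    IsEdgeSubsetOf S M → ∀ {x} → x ∈ ∁ S → mate M x ∈ ∁ S
complement-closed {M = M} {S} closed {x} x∈∁S =
  x∉p⇒x∈∁p λ x′∈S → x∈∁p⇒x∉p x∈∁S (subst (_∈ S) (mate-invol M x) (closed _ x′∈S))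

forcing⇒no-alternating-cycle : ∀ {N} {G : Graph N} → (∀ {a b} → G a b → G b a) →
                               {M : PerfectMatching G} {S : Subset N} →
                               IsForcingSet M S → ¬ AlternatingCycle M (∁ S)
forcing⇒no-alternating-cycle G-sym {M} {S} (closed , forces) cycle =
  y≢mate-x (trans (sym rotate-x) (forces rotated agree x))
  where
  open AlternatingCycle cycle
  open Rotation G-sym M y≢x y≢mate-x edge mate-edge
  outside-S : ∀ {z w} → z ∈ S → w ∈ ∁ S → z ≢ w
  outside-S z∈S w∈∁S refl = x∈∁p⇒x∉p w∈∁S z∈S
  agree : ContainedIn S M rotated
  agree z z∈S = rotate-elsewhere (outside-S z∈S x∈C) (outside-S z∈S y∈C)
    (outside-S z∈S (complement-closed {M = M} closed x∈C)) (outside-S z∈S (complement-closed {M = M} closed y∈C))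

-- The graph H_k on Fin n ⊎ Fin n

side : ∀ {n} → Fin n ⊎ Fin n → Bool
side = [ (λ _ → true) , (λ _ → false) ]′

index : ∀ {n} → Fin n ⊎ Fin n → ℕ
index = [ toℕ , toℕ ]′

side-index-injective : ∀ {n} {a b : Fin n ⊎ Fin n} → side a ≡ side b → index a ≡ index b → a ≡ b
side-index-injective {a = inj₁ i} {inj₁ j} _ eq = cong inj₁ (Finₚ.toℕ-injective eq)
side-index-injective {a = inj₂ i} {inj₂ j} _ eq = cong inj₂ (Finₚ.toℕ-injective eq)

Paired-sym : ∀ {n k} {i j : Fin n} → Paired k i j → Paired k j i
Paired-sym (t , t<k , ij) = t , t<k , Sum.swap (Sum.map Product.swap Product.swap ij)

HRel-sym : ∀ {n k} {a b : Fin n ⊎ Fin n} → HRel n k a b → HRel n k b a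
HRel-sym {a = inj₁ i} {inj₁ j} = Paired-sym
HRel-sym {a = inj₂ i} {inj₂ j} = Paired-sym
HRel-sym {a = inj₁ i} {inj₂ j} = id
HRel-sym {a = inj₂ i} {inj₁ j} = id

HRel-same-side⇒Partners : ∀ {n k} {a b : Fin n ⊎ Fin n} →
                          side a ≡ side b → HRel n k a b → Partners k (index a) (index b)
HRel-same-side⇒Partners {a = inj₁ i} {inj₁ j} _ = Paired⇒Partners
HRel-same-side⇒Partners {a = inj₂ i} {inj₂ j} _ = Paired⇒Partners

Partners⇒HRel-same-side : ∀ {n k} {a b : Fin n ⊎ Fin n} →
                          side a ≡ side b → Partners k (index a) (index b) → HRel n k a b
Partners⇒HRel-same-side {a = inj₁ i} {inj₁ j} _ = Partners⇒Paired
Partners⇒HRel-same-side {a = inj₂ i} {inj₂ j} _ = Partners⇒Paired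

¬Partners⇒HRel-opposite : ∀ {n k} {a b : Fin n ⊎ Fin n} →
                          side a ≢ side b → ¬ Partners k (index a) (index b) → HRel n k a b
¬Partners⇒HRel-opposite {a = inj₁ i} {inj₁ j} sides≢ = contradiction refl sides≢
¬Partners⇒HRel-opposite {a = inj₂ i} {inj₂ j} sides≢ = contradiction refl sides≢
¬Partners⇒HRel-opposite {a = inj₁ i} {inj₂ j} _ ¬ij with i Finₚ.≟ j
... | yes i≡j = inj₁ i≡j
... | no  i≢j = inj₂ (i≢j , ¬ij ∘ Paired⇒Partners)
¬Partners⇒HRel-opposite {a = inj₂ j} {inj₁ i} _ ¬ji with i Finₚ.≟ j
... | yes i≡j = inj₁ i≡j
... | no  i≢j = inj₂ (i≢j , ¬ji ∘ Partners-sym ∘ Paired⇒Partners)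

splitAt-injective : ∀ m {n} {x y : Fin (m + n)} → splitAt m x ≡ splitAt m y → x ≡ y
splitAt-injective m {n} {x} {y} eq =
  trans (sym (Finₚ.join-splitAt m n x)) (trans (cong (join m n) eq) (Finₚ.join-splitAt m n y))

perfect-matching-on-sum : ∀ {n k} (f : Fin n ⊎ Fin n → Fin n ⊎ Fin n) → (∀ a → HRel n k a (f a)) →
                          (∀ a → f a ≢ a) → (∀ a → f (f a) ≡ a) → PerfectMatching (H n k)
perfect-matching-on-sum {n} {k} f adjacent irreflexive involutive = record
  { mate       = λ x → join n n (f (splitAt n x))
  ; mate-adj   = λ x → subst (HRel n k (splitAt n x)) (sym (Finₚ.splitAt-join n n _)) (adjacent (splitAt n x))
  ; mate-irr   = λ x eq → irreflexive (splitAt n x) (trans (sym (Finₚ.splitAt-join n n _)) (cong (splitAt n) eq))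
  ; mate-invol = λ x → begin
      join n n (f (splitAt n (join n n (f (splitAt n x))))) ≡⟨ cong (join n n ∘ f) (Finₚ.splitAt-join n n _) ⟩
      join n n (f (f (splitAt n x)))                         ≡⟨ cong (join n n) (involutive _) ⟩
      join n n (splitAt n x)                                 ≡⟨ Finₚ.join-splitAt n n x ⟩
      x                                                      ∎
  }
  where open ≡-Reasoning

HRel-swap : ∀ {n k} (a : Fin n ⊎ Fin n) → HRel n k a (Sum.swap a)
HRel-swap (inj₁ i) = inj₁ refl
HRel-swap (inj₂ i) = inj₁ refl

-- The lower bound

module LowerBound (n k : ℕ) (M : PerfectMatching (H n k)) (C : Subset (n + n))
                  (closed : ∀ {x} → x ∈ C → mate M x ∈ C) where

  private
    V : Set
    V = Fin (n + n)

    m : V → V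
    m = mate M

    σ : V → Bool
    σ x = side (splitAt n x)

    ι : V → ℕ
    ι x = index (splitAt n x)

  same-side-injective : ∀ {x y} → σ x ≡ σ y → ι x ≡ ι y → x ≡ y
  same-side-injective σ≡ ι≡ = splitAt-injective n (side-index-injective σ≡ ι≡)

  opposite-sides : ∀ {s x y} → σ x ≡ s → σ y ≡ not s → σ x ≢ σ y
  opposite-sides {s} σx σy σ≡ = not-¬ refl (trans (sym σx) (trans σ≡ σy))

  opposite-sides⇒≢ : ∀ {s x y} → σ x ≡ s → σ y ≡ not s → x ≢ y
  opposite-sides⇒≢ σx σy = opposite-sides σx σy ∘ cong σ

  ¬Partners⇒edge : ∀ {x y} → σ x ≢ σ y → ¬ Partners k (ι x) (ι y) → H n k x y
  ¬Partners⇒edge = ¬Partners⇒HRel-opposite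

  Internal : Bool → V → Set
  Internal s x = x ∈ C × σ x ≡ s × σ (m x) ≡ s

  Internal? : ∀ s x → Dec (Internal s x)
  Internal? s x = (x Subsetₚ.∈? C) ×-dec (σ x Boolₚ.≟ s) ×-dec (σ (m x) Boolₚ.≟ s)

  internal⇒Partners : ∀ {s x} → Internal s x → Partners k (ι x) (ι (m x))
  internal⇒Partners {x = x} (_ , σx , σx′) = HRel-same-side⇒Partners (trans σx (sym σx′)) (mate-adj M x)

  opposite-internal-edges⇒cycle : ∀ {s x y} → Internal s x → Internal (not s) y → AlternatingCycle M C
  -- If x and y are partners the cycle runs through x and mate y, otherwise through x and y.
  opposite-internal-edges⇒cycle {s} {x} {y} ix@(x∈C , σx , σx′) iy@(y∈C , σy , σy′)
    with Partners? k (ι x) (ι y)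
  ... | yes xy = record
    { x∈C       = x∈C
    ; y∈C       = closed y∈C
    ; y≢x       = opposite-sides⇒≢ σx σy′ ∘ sym
    ; y≢mate-x  = opposite-sides⇒≢ σx′ σy′ ∘ sym
    ; edge      = ¬Partners⇒edge (opposite-sides σx σy′) λ xy′ →
                    Partners-irreflexive (subst (Partners k (ι x))
                      (sym (Partners-injective xy′ (internal⇒Partners iy))) xy)
    ; mate-edge = subst (H n k (m x)) (sym (mate-invol M y)) (¬Partners⇒edge (opposite-sides σx′ σy) λ x′y →
                    Partners-irreflexive (subst (Partners k (ι (m x)))
                      (Partners-functional xy (internal⇒Partners ix)) x′y))
    }
  ... | no ¬xy = record
    { x∈C       = x∈C
    ; y∈C       = y∈C
    ; y≢x       = opposite-sides⇒≢ σx σy ∘ sym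
    ; y≢mate-x  = opposite-sides⇒≢ σx′ σy ∘ sym
    ; edge      = ¬Partners⇒edge (opposite-sides σx σy) ¬xy
    ; mate-edge = ¬Partners⇒edge (opposite-sides σx′ σy′) λ x′y′ →
                    ¬xy (Partners-sym (subst (Partners k (ι y))
                      (sym (Partners-functional (Partners-sym (internal⇒Partners ix)) x′y′)) (internal⇒Partners iy)))
    }

  module OneSided (s : Bool) (one-sided : ∀ {x} → ¬ Internal (not s) x) where

    Crossing : V → Set
    Crossing x = x ∈ C × σ x ≡ s × σ (m x) ≡ not s

    Crossing? : ∀ x → Dec (Crossing x)
    Crossing? x = (x Subsetₚ.∈? C) ×-dec (σ x Boolₚ.≟ s) ×-dec (σ (m x) Boolₚ.≟ not s)

    classify : ∀ {x} → x ∈ C → Internal s x ⊎ Crossing x ⊎ Crossing (m x)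
    classify {x} x∈C with σ x Boolₚ.≟ s | σ (m x) Boolₚ.≟ s
    ... | yes σx | yes σx′ = inj₁ (x∈C , σx , σx′)
    ... | yes σx | no  σx′ = inj₂ (inj₁ (x∈C , σx , ¬-not σx′))
    ... | no  σx | yes σx′ = inj₂ (inj₂ (closed x∈C , σx′ , subst (λ z → σ z ≡ not s) (sym (mate-invol M x)) (¬-not σx)))
    ... | no  σx | no  σx′ = contradiction (x∈C , ¬-not σx , ¬-not σx′) one-sided

    block : V → ℕ
    block x = ⌊ ι x /2⌋

    same-block-as-internal : ∀ {c y} → Internal s y → σ c ≡ s → block c ≡ block y → c ≡ y ⊎ c ≡ m y
    same-block-as-internal {c} {y} iy@(_ , σy , σy′) σc eq with same-block (ι y) (ι c) (sym eq)
    ... | inj₁ ι≡ = inj₁ (same-side-injective (trans σc (sym σy)) ι≡)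
    ... | inj₂ ι≡ = inj₂ (same-side-injective (trans σc (sym σy′)) (trans ι≡ (Partners.partner-of (internal⇒Partners iy))))

    internal-block-injective : ∀ {x y} → Internal s x → Internal s y → block x ≡ block y → y ≡ x ⊎ y ≡ m x
    internal-block-injective ix (_ , σy , _) eq = same-block-as-internal ix σy (sym eq)

    crossing-block≢internal-block : ∀ {c y} → Crossing c → Internal s y → block c ≢ block y
    crossing-block≢internal-block {c} {y} (_ , σc , σc′) iy@(_ , σy , σy′) eq with same-block-as-internal iy σc eq
    ... | inj₁ refl = not-¬ refl (trans (sym σy′) σc′)
    ... | inj₂ refl = not-¬ refl (trans (sym σy) (trans (cong σ (sym (mate-invol M y))) σc′))

    -- x ⇝ z: x and mate z lie in a common block, so they are not adjacent.
    _⇝_ : V → V → Set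
    x ⇝ z = Partners k (ι x) (ι (m z))

    Related : V → V → Set
    Related x z = x ⇝ z ⊎ z ⇝ x

    crossing⇒cycle-or-related : ∀ {x z} → Crossing x → Crossing z → x ≢ z → AlternatingCycle M C ⊎ Related x z
    crossing⇒cycle-or-related {x} {z} (x∈C , σx , σx′) (z∈C , σz , σz′) x≢z
      with Partners? k (ι x) (ι (m z)) | Partners? k (ι z) (ι (m x))
    ... | yes x⇝z | _       = inj₂ (inj₁ x⇝z)
    ... | no  _   | yes z⇝x = inj₂ (inj₂ z⇝x)
    ... | no ¬x⇝z | no ¬z⇝x = inj₁ (record
      { x∈C       = x∈C
      ; y∈C       = closed z∈C
      ; y≢x       = opposite-sides⇒≢ σx σz′ ∘ sym
      ; y≢mate-x  = x≢z ∘ sym ∘ mate-injective M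
      ; edge      = ¬Partners⇒edge (opposite-sides σx σz′) ¬x⇝z
      ; mate-edge = subst (H n k (m x)) (sym (mate-invol M z))
                      (¬Partners⇒edge (opposite-sides σz σx′ ∘ sym) (¬z⇝x ∘ Partners-sym))
      })

    ⇝-functional : ∀ {x z z′} → Crossing z → Crossing z′ → x ⇝ z → x ⇝ z′ → z ≡ z′
    ⇝-functional (_ , _ , σz′) (_ , _ , σz′′) x⇝z x⇝z′ =
      mate-injective M (same-side-injective (trans σz′ (sym σz′′)) (Partners-functional x⇝z x⇝z′))

    ⇝-injective : ∀ {x x′ z} → Crossing x → Crossing x′ → x ⇝ z → x′ ⇝ z → x ≡ x′
    ⇝-injective (_ , σx , _) (_ , σx′ , _) x⇝z x′⇝z =
      same-side-injective (trans σx (sym σx′)) (Partners-injective x⇝z x′⇝z)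

    private
      _≟ₘ_ : (e e′ : Maybe V) → Dec (e ≡ e′)
      _≟ₘ_ = Maybeₚ.≡-dec Finₚ._≟_

    -- Internal edges are labelled by their block (< k), crossing edges by the block of their end
    -- on side s, except the edge of e, which takes the spare label k.
    crossing-label : Maybe V → V → ℕ
    crossing-label e c with e ≟ₘ just c
    ... | yes _ = k
    ... | no  _ = block c

    label : Maybe V → V → ℕ
    label e x with Crossing? x | Crossing? (m x)
    ... | yes _ | _     = crossing-label e x
    ... | no  _ | yes _ = crossing-label e (m x)
    ... | no  _ | no  _ = block x

    OnEdge : V → V → Set
    OnEdge c x = x ≡ c ⊎ x ≡ m c

    on-same-edge : ∀ {c x y} → OnEdge c x → OnEdge c y → y ≡ x ⊎ y ≡ m x
    on-same-edge     (inj₁ refl) (inj₁ refl) = inj₁ refl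
    on-same-edge     (inj₁ refl) (inj₂ refl) = inj₂ refl
    on-same-edge {c} (inj₂ refl) (inj₁ refl) = inj₂ (sym (mate-invol M c))
    on-same-edge     (inj₂ refl) (inj₂ refl) = inj₁ refl

    label-view : ∀ e {x} → x ∈ C → (Internal s x × label e x ≡ block x) ⊎
                 (∃ λ c → Crossing c × OnEdge c x × label e x ≡ crossing-label e c)
    label-view e {x} x∈C with Crossing? x | Crossing? (m x)
    ... | yes cx | _      = inj₂ (x , cx , inj₁ refl , refl)
    ... | no  _  | yes cx′ = inj₂ (m x , cx′ , inj₂ (sym (mate-invol M x)) , refl)
    ... | no ¬cx | no ¬cx′ with classify x∈C
    ...   | inj₁ ix         = inj₁ (ix , refl)
    ...   | inj₂ (inj₁ cx)  = contradiction cx ¬cx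
    ...   | inj₂ (inj₂ cx′) = contradiction cx′ ¬cx′

    internal-block-< : ∀ {x} → Internal s x → block x < k
    internal-block-< ix = ⌊/2⌋-< (Partners.below (internal⇒Partners ix))

    bound-with-exception :
      (e : Maybe V) →
      (∀ {c} → Crossing c → e ≢ just c → ι c < 2 * k) →
      (∀ {c d} → Crossing c → Crossing d → e ≢ just c → e ≢ just d → block c ≡ block d → c ≡ d) →
      ∣ C ∣ ≤ 2 * suc k
    bound-with-exception e low distinct =
      labelled-edges⇒∣p∣≤2b m (mate-invol M) (mate-irr M) C (suc k) (label e) label-< label-injective
      where
      crossing-label-< : ∀ {c} → Crossing c → crossing-label e c < suc k
      crossing-label-< {c} cc with e ≟ₘ just c
      ... | yes _   = n<1+n k
      ... | no  e≢c = m<n⇒m<1+n (⌊/2⌋-< (low cc e≢c))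

      crossing-label-injective : ∀ {c d} → Crossing c → Crossing d → crossing-label e c ≡ crossing-label e d → c ≡ d
      crossing-label-injective {c} {d} cc cd eq with e ≟ₘ just c | e ≟ₘ just d
      ... | yes e≡c | yes e≡d = Maybeₚ.just-injective (trans (sym e≡c) e≡d)
      ... | yes _   | no  e≢d = contradiction (subst (_< k) (sym eq) (⌊/2⌋-< (low cd e≢d))) (<-irrefl refl)
      ... | no  e≢c | yes _   = contradiction (subst (_< k) eq (⌊/2⌋-< (low cc e≢c))) (<-irrefl refl)
      ... | no  e≢c | no  e≢d = distinct cc cd e≢c e≢d eq

      internal≢crossing : ∀ {x c} → Internal s x → Crossing c → block x ≢ crossing-label e c
      internal≢crossing {x} {c} ix cc eq with e ≟ₘ just c
      ... | yes _ = <-irrefl eq (internal-block-< ix)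
      ... | no  _ = crossing-block≢internal-block cc ix (sym eq)

      label-< : ∀ {x} → x ∈ C → label e x < suc k
      label-< x∈C with label-view e x∈C
      ... | inj₁ (ix , eq)          = subst (_< suc k) (sym eq) (m<n⇒m<1+n (internal-block-< ix))
      ... | inj₂ (c , cc , _ , eq)  = subst (_< suc k) (sym eq) (crossing-label-< cc)

      label-injective : ∀ {x y} → x ∈ C → y ∈ C → label e x ≡ label e y → y ≡ x ⊎ y ≡ m x
      label-injective x∈C y∈C eq with label-view e x∈C | label-view e y∈C
      ... | inj₁ (ix , ex) | inj₁ (iy , ey) = internal-block-injective ix iy (trans (sym ex) (trans eq ey))
      ... | inj₁ (ix , ex) | inj₂ (d , cd , _ , ey) = contradiction (trans (sym ex) (trans eq ey)) (internal≢crossing ix cd)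
      ... | inj₂ (c , cc , _ , ex) | inj₁ (iy , ey) = contradiction (trans (sym ey) (trans (sym eq) ex)) (internal≢crossing iy cc)
      ... | inj₂ (c , cc , xc , ex) | inj₂ (d , cd , yd , ey)
        with crossing-label-injective cc cd (trans (sym ex) (trans eq ey))
      ...   | refl = on-same-edge xc yd

    at-most-one-crossing⇒bound : (e : Maybe V) → (∀ {x} → Crossing x → e ≡ just x) → ∣ C ∣ ≤ 2 * suc k
    at-most-one-crossing⇒bound e only-e =
      bound-with-exception e (λ cx e≢x → contradiction (only-e cx) e≢x) (λ cx _ e≢x _ _ → contradiction (only-e cx) e≢x)

    own-blocks⇒bound : ∀ {a b} (e : Maybe V) → ι a < 2 * k → ι b < 2 * k → a ≡ b ⊎ block a ≢ block b →
                       (∀ {x} → Crossing x → e ≢ just x → x ≡ a ⊎ x ≡ b) → ∣ C ∣ ≤ 2 * suc k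
    own-blocks⇒bound {a} {b} e a-low b-low a≡b⊎blocks≢ others = bound-with-exception e low distinct
      where
      low : ∀ {x} → Crossing x → e ≢ just x → ι x < 2 * k
      low cx e≢x with others cx e≢x
      ... | inj₁ refl = a-low
      ... | inj₂ refl = b-low
      same-block⇒a≡b : block a ≡ block b → a ≡ b
      same-block⇒a≡b eq = [ (λ a≡b → a≡b) , (λ blocks≢ → contradiction eq blocks≢) ]′ a≡b⊎blocks≢
      distinct : ∀ {x y} → Crossing x → Crossing y → e ≢ just x → e ≢ just y → block x ≡ block y → x ≡ y
      distinct cx cy e≢x e≢y eq with others cx e≢x | others cy e≢y
      ... | inj₁ refl | inj₁ refl = refl
      ... | inj₂ refl | inj₂ refl = refl
      ... | inj₁ refl | inj₂ refl = same-block⇒a≡b eq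
      ... | inj₂ refl | inj₁ refl = sym (same-block⇒a≡b (sym eq))

    related-to-two⇒low : ∀ {x y z} → Crossing y → Crossing z → y ≢ z → Related x y → Related x z → ι x < 2 * k
    related-to-two⇒low _  _  _   (inj₁ x⇝y) _          = Partners.below x⇝y
    related-to-two⇒low _  _  _   (inj₂ _)   (inj₁ x⇝z) = Partners.below x⇝z
    related-to-two⇒low cy cz y≢z (inj₂ y⇝x) (inj₂ z⇝x) = contradiction (⇝-injective cy cz y⇝x z⇝x) y≢z

    -- ⇝ has in- and out-degree at most one.
    ¬related-to-three : ∀ {a b c d} → Crossing b → Crossing c → Crossing d → b ≢ c → b ≢ d → c ≢ d →
                        Related a b → Related a c → Related a d → ⊥
    ¬related-to-three cb cc cd b≢c b≢d c≢d (inj₁ a⇝b) (inj₁ a⇝c) _          = b≢c (⇝-functional cb cc a⇝b a⇝c)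
    ¬related-to-three cb cc cd b≢c b≢d c≢d (inj₂ b⇝a) (inj₂ c⇝a) _          = b≢c (⇝-injective cb cc b⇝a c⇝a)
    ¬related-to-three cb cc cd b≢c b≢d c≢d (inj₁ a⇝b) (inj₂ c⇝a) (inj₁ a⇝d) = b≢d (⇝-functional cb cd a⇝b a⇝d)
    ¬related-to-three cb cc cd b≢c b≢d c≢d (inj₁ a⇝b) (inj₂ c⇝a) (inj₂ d⇝a) = c≢d (⇝-injective cc cd c⇝a d⇝a)
    ¬related-to-three cb cc cd b≢c b≢d c≢d (inj₂ b⇝a) (inj₁ a⇝c) (inj₁ a⇝d) = c≢d (⇝-functional cc cd a⇝c a⇝d)
    ¬related-to-three cb cc cd b≢c b≢d c≢d (inj₂ b⇝a) (inj₁ a⇝c) (inj₂ d⇝a) = b≢d (⇝-injective cb cd b⇝a d⇝a)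

    three-in-a-block : ∀ {a b c} → Crossing a → Crossing b → Crossing c → a ≢ b → a ≢ c → b ≢ c →
                       block a ≡ block b → block a ≢ block c
    three-in-a-block {a} {b} {c} (_ , σa , _) (_ , σb , _) (_ , σc , _) a≢b a≢c b≢c ab ac
      with same-block (ι a) (ι b) ab | same-block (ι a) (ι c) ac
    ... | inj₁ b≡a  | _         = a≢b (sym (same-side-injective (trans σb (sym σa)) b≡a))
    ... | _         | inj₁ c≡a  = a≢c (sym (same-side-injective (trans σc (sym σa)) c≡a))
    ... | inj₂ b≡a′ | inj₂ c≡a′ = b≢c (same-side-injective (trans σb (sym σc)) (trans b≡a′ (sym c≡a′)))

    two-crossings⇒cycle-or-bound : ∀ {a b} → Crossing a → Crossing b → a ≢ b →
                                   (∀ {x} → Crossing x → x ≡ a ⊎ x ≡ b) → AlternatingCycle M C ⊎ ∣ C ∣ ≤ 2 * suc k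
    two-crossings⇒cycle-or-bound {a} {b} ca cb a≢b only-ab with crossing⇒cycle-or-related ca cb a≢b
    ... | inj₁ cycle      = inj₁ cycle
    ... | inj₂ (inj₁ a⇝b) = inj₂ (own-blocks⇒bound (just b) (Partners.below a⇝b) (Partners.below a⇝b) (inj₁ refl)
          λ cx b≢x → case only-ab cx of λ { (inj₁ refl) → inj₁ refl ; (inj₂ refl) → contradiction refl b≢x })
    ... | inj₂ (inj₂ b⇝a) = inj₂ (own-blocks⇒bound (just a) (Partners.below b⇝a) (Partners.below b⇝a) (inj₁ refl)
          λ cx a≢x → case only-ab cx of λ { (inj₁ refl) → contradiction refl a≢x ; (inj₂ refl) → inj₁ refl })

    three-crossings⇒cycle-or-bound : ∀ {a b c} → Crossing a → Crossing b → Crossing c → a ≢ b → a ≢ c → b ≢ c →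
                                     (∀ {x} → Crossing x → x ≡ a ⊎ x ≡ b ⊎ x ≡ c) →
                                     AlternatingCycle M C ⊎ ∣ C ∣ ≤ 2 * suc k
    three-crossings⇒cycle-or-bound {a} {b} {c} ca cb cc a≢b a≢c b≢c only-abc
      with crossing⇒cycle-or-related ca cb a≢b | crossing⇒cycle-or-related ca cc a≢c | crossing⇒cycle-or-related cb cc b≢c
    ... | inj₁ cycle | _          | _          = inj₁ cycle
    ... | inj₂ _     | inj₁ cycle | _          = inj₁ cycle
    ... | inj₂ _     | inj₂ _     | inj₁ cycle = inj₁ cycle
    ... | inj₂ ab    | inj₂ ac    | inj₂ bc    with block a ≟ block b
    ...   | no blocks≢ = inj₂ (own-blocks⇒bound (just c)
              (related-to-two⇒low cb cc b≢c ab ac) (related-to-two⇒low ca cc a≢c (Sum.swap ab) bc) (inj₂ blocks≢)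
              λ cx c≢x → case only-abc cx of λ
                { (inj₁ refl) → inj₁ refl ; (inj₂ (inj₁ refl)) → inj₂ refl ; (inj₂ (inj₂ refl)) → contradiction refl c≢x })
    ...   | yes ab-block = inj₂ (own-blocks⇒bound (just b)
              (related-to-two⇒low cb cc b≢c ab ac) (related-to-two⇒low ca cb a≢b (Sum.swap ac) (Sum.swap bc))
              (inj₂ (three-in-a-block ca cb cc a≢b a≢c b≢c ab-block))
              λ cx b≢x → case only-abc cx of λ
                { (inj₁ refl) → inj₁ refl ; (inj₂ (inj₁ refl)) → contradiction refl b≢x ; (inj₂ (inj₂ refl)) → inj₂ refl })

    four-crossings⇒cycle : ∀ {a b c d} → Crossing a → Crossing b → Crossing c → Crossing d →
                           a ≢ b → a ≢ c → a ≢ d → b ≢ c → b ≢ d → c ≢ d → AlternatingCycle M C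
    four-crossings⇒cycle ca cb cc cd a≢b a≢c a≢d b≢c b≢d c≢d
      with crossing⇒cycle-or-related ca cb a≢b | crossing⇒cycle-or-related ca cc a≢c | crossing⇒cycle-or-related ca cd a≢d
    ... | inj₁ cycle | _          | _          = cycle
    ... | inj₂ _     | inj₁ cycle | _          = cycle
    ... | inj₂ _     | inj₂ _     | inj₁ cycle = cycle
    ... | inj₂ ab    | inj₂ ac    | inj₂ ad    = ⊥-elim (¬related-to-three cb cc cd b≢c b≢d c≢d ab ac ad)

    listed-crossings⇒cycle-or-bound : (cs : List V) → Unique cs → (∀ {x} → Crossing x → x ∈ₗ cs) →
                                      (∀ {x} → x ∈ₗ cs → Crossing x) → AlternatingCycle M C ⊎ ∣ C ∣ ≤ 2 * suc k
    listed-crossings⇒cycle-or-bound [] _ complete _ =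
      inj₂ (at-most-one-crossing⇒bound nothing λ cx → case complete cx of λ ())
    listed-crossings⇒cycle-or-bound (a ∷ []) _ complete _ =
      inj₂ (at-most-one-crossing⇒bound (just a) λ cx → case complete cx of λ { (here refl) → refl })
    listed-crossings⇒cycle-or-bound (a ∷ b ∷ []) ((a≢b ∷ []) ∷ _) complete sound =
      two-crossings⇒cycle-or-bound (sound (here refl)) (sound (there (here refl))) a≢b
        λ cx → case complete cx of λ { (here refl) → inj₁ refl ; (there (here refl)) → inj₂ refl }
    listed-crossings⇒cycle-or-bound (a ∷ b ∷ c ∷ []) ((a≢b ∷ a≢c ∷ []) ∷ (b≢c ∷ []) ∷ _) complete sound =
      three-crossings⇒cycle-or-bound (sound (here refl)) (sound (there (here refl))) (sound (there (there (here refl))))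
        a≢b a≢c b≢c λ cx → case complete cx of λ
          { (here refl) → inj₁ refl ; (there (here refl)) → inj₂ (inj₁ refl) ; (there (there (here refl))) → inj₂ (inj₂ refl) }
    listed-crossings⇒cycle-or-bound (a ∷ b ∷ c ∷ d ∷ _) ((a≢b ∷ a≢c ∷ a≢d ∷ _) ∷ (b≢c ∷ b≢d ∷ _) ∷ (c≢d ∷ _) ∷ _) _ sound =
      inj₁ (four-crossings⇒cycle (sound (here refl)) (sound (there (here refl))) (sound (there (there (here refl))))
              (sound (there (there (there (here refl))))) a≢b a≢c a≢d b≢c b≢d c≢d)

    cycle-or-bound : AlternatingCycle M C ⊎ ∣ C ∣ ≤ 2 * suc k
    cycle-or-bound = listed-crossings⇒cycle-or-bound (filter Crossing? (allFin (n + n)))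
      (Uniqueₚ.filter⁺ Crossing? (Uniqueₚ.allFin⁺ (n + n)))
      (λ cx → ∈-filter⁺ Crossing? (∈-allFin _) cx)
      (λ x∈ → proj₂ (∈-filter⁻ Crossing? {xs = allFin (n + n)} x∈))

  cycle-or-bound : AlternatingCycle M C ⊎ ∣ C ∣ ≤ 2 * suc k
  cycle-or-bound with Finₚ.any? (Internal? true) | Finₚ.any? (Internal? false)
  ... | yes (_ , ix) | yes (_ , iy) = inj₁ (opposite-internal-edges⇒cycle ix iy)
  ... | no  ¬true    | _            = OneSided.cycle-or-bound false (λ ix → ¬true (_ , ix))
  ... | _            | no  ¬false   = OneSided.cycle-or-bound true (λ ix → ¬false (_ , ix))

n∸[1+k]≡n∸k∸1 : ∀ n k → n ∸ suc k ≡ n ∸ k ∸ 1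
n∸[1+k]≡n∸k∸1 n k = trans (cong (n ∸_) (+-comm 1 k)) (sym (∸-+-assoc n k 1))

double-∸-bound : ∀ a b c → a + a ∸ c ≤ 2 * b → 2 * (a ∸ b) ≤ c
double-∸-bound a b c a+a∸c≤2b = begin
  2 * (a ∸ b)    ≡⟨ *-distribˡ-∸ 2 a b ⟩
  2 * a ∸ 2 * b  ≤⟨ m≤n+o⇒m∸n≤o (2 * a) (2 * b) 2a≤2b+c ⟩
  c              ∎
  where
  open ≤-Reasoning
  2a≤2b+c : 2 * a ≤ 2 * b + c
  2a≤2b+c = begin
    2 * a             ≡⟨ cong (a +_) (+-identityʳ a) ⟩
    a + a             ≤⟨ m≤n+m∸n (a + a) c ⟩
    c + (a + a ∸ c)   ≤⟨ +-monoʳ-≤ c a+a∸c≤2b ⟩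
    c + 2 * b         ≡⟨ +-comm c (2 * b) ⟩
    2 * b + c         ∎

forcing-set-lower-bound : ∀ n k (M : PerfectMatching (H n k)) (S : Subset (n + n)) →
                          IsForcingSet M S → 2 * (n ∸ k ∸ 1) ≤ ∣ S ∣
forcing-set-lower-bound n k M S forcing@(closed , _)
  with LowerBound.cycle-or-bound n k M (∁ S) (complement-closed {M = M} closed)
... | inj₁ cycle = contradiction cycle (forcing⇒no-alternating-cycle HRel-sym forcing)
... | inj₂ bound = subst (λ b → 2 * b ≤ ∣ S ∣) (n∸[1+k]≡n∸k∸1 n k)
                     (double-∸-bound n (suc k) ∣ S ∣ (subst (_≤ 2 * suc k) (∣∁p∣≡n∸∣p∣ S) bound))

-- The upper bound

module UpperBound (n′ k : ℕ) (2k≤n′ : 2 * k ≤ n′) where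

  private
    n : ℕ
    n = suc n′

    V : Set
    V = Fin n ⊎ Fin n

  partnerFin : (i : Fin n) → toℕ i < 2 * k → Fin n
  partnerFin i i<2k = Fin.fromℕ< (≤-trans (partner-< {k} i<2k) (m≤n⇒m≤1+n 2k≤n′))

  mate₀ : V → V
  mate₀ a with index a <? 2 * k
  mate₀ (inj₁ i) | yes i<2k = inj₁ (partnerFin i i<2k)
  mate₀ (inj₂ i) | yes i<2k = inj₂ (partnerFin i i<2k)
  mate₀ a        | no  _    = Sum.swap a

  data Mate₀View (a b : V) : Set where
    same-side : index a < 2 * k → side b ≡ side a → index b ≡ partner (index a) → Mate₀View a b
    swapped   : index a ≮ 2 * k → b ≡ Sum.swap a → Mate₀View a b

  mate₀-view : ∀ a → Mate₀View a (mate₀ a)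
  mate₀-view a with index a <? 2 * k
  mate₀-view (inj₁ i) | yes i<2k = same-side i<2k refl (Finₚ.toℕ-fromℕ< _)
  mate₀-view (inj₂ i) | yes i<2k = same-side i<2k refl (Finₚ.toℕ-fromℕ< _)
  mate₀-view (inj₁ i) | no  i≮2k = swapped i≮2k refl
  mate₀-view (inj₂ i) | no  i≮2k = swapped i≮2k refl

  private
    index-swap : ∀ (a : V) → index (Sum.swap a) ≡ index a
    index-swap (inj₁ _) = refl
    index-swap (inj₂ _) = refl

  mate₀-adjacent : ∀ a → HRel n k a (mate₀ a)
  mate₀-adjacent a with mate₀-view a
  ... | same-side a<2k side≡ index≡ = Partners⇒HRel-same-side (sym side≡) (a<2k , sym index≡)
  ... | swapped _ mate≡swap         = subst (HRel n k a) (sym mate≡swap) (HRel-swap a)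

  mate₀-irreflexive : ∀ a → mate₀ a ≢ a
  mate₀-irreflexive a eq with mate₀-view a
  ... | same-side _ _ index≡ = partner-irreflexive (index a) (trans (sym index≡) (cong index eq))
  mate₀-irreflexive (inj₁ i) eq | swapped _ mate≡swap with () ← trans (sym mate≡swap) eq
  mate₀-irreflexive (inj₂ i) eq | swapped _ mate≡swap with () ← trans (sym mate≡swap) eq

  mate₀-involutive : ∀ a → mate₀ (mate₀ a) ≡ a
  mate₀-involutive a with mate₀-view a
  ... | same-side a<2k side≡ index≡ with mate₀-view (mate₀ a)
  ...   | same-side _ side≡′ index≡′ = side-index-injective (trans side≡′ side≡)
            (trans index≡′ (trans (cong partner index≡) (partner-involutive (index a))))
  ...   | swapped a′≮2k _ = contradiction (subst (_< 2 * k) (sym index≡) (partner-< {k} a<2k)) a′≮2k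
  mate₀-involutive a | swapped a≮2k mate≡swap rewrite mate≡swap with mate₀-view (Sum.swap a)
  ...   | same-side a′<2k _ _ = contradiction (subst (_< 2 * k) (index-swap a) a′<2k) a≮2k
  ...   | swapped _ mate≡swap′ = trans mate≡swap′ (Sumₚ.swap-involutive a)

  M₀ : PerfectMatching (H n k)
  M₀ = perfect-matching-on-sum mate₀ mate₀-adjacent mate₀-irreflexive mate₀-involutive

  -- The endpoints of the k u-blocks of M₀ and of all its u_i v_i edges except the last one.
  InS₀ : V → Set
  InS₀ (inj₁ i) = toℕ i < n′
  InS₀ (inj₂ i) = 2 * k ≤ toℕ i × toℕ i < n′

  S₀ : Subset (n + n)
  S₀ = interval {n} 0 n′ Vec.++ interval {n} (2 * k) n′

  ∈S₀⁺ : ∀ {a} → InS₀ a → join n n a ∈ S₀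
  ∈S₀⁺ {inj₁ i} i<n′          = ∈-++ˡ⁺ (∈-interval⁺ z≤n i<n′)
  ∈S₀⁺ {inj₂ i} (2k≤i , i<n′) = ∈-++ʳ⁺ {p = interval {n} 0 n′} (∈-interval⁺ 2k≤i i<n′)

  ∈S₀⁻ : ∀ {a} → join n n a ∈ S₀ → InS₀ a
  ∈S₀⁻ {inj₁ i} a∈ = proj₂ (∈-interval⁻ {a = 0} (∈-++ˡ⁻ {q = interval {n} (2 * k) n′} a∈))
  ∈S₀⁻ {inj₂ i} a∈ = ∈-interval⁻ (∈-++ʳ⁻ {p = interval {n} 0 n′} a∈)

  ∣S₀∣ : ∣ S₀ ∣ ≡ n′ + (n′ ∸ 2 * k)
  ∣S₀∣ = trans (∣p++q∣ (interval {n} 0 n′) (interval {n} (2 * k) n′))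
               (cong₂ _+_ (∣interval∣ 0 n′ (n≤1+n n′)) (∣interval∣ (2 * k) n′ (n≤1+n n′)))

  InS₀-closed : ∀ {a} → InS₀ a → InS₀ (mate₀ a)
  InS₀-closed {inj₁ i} i<n′ with toℕ i <? 2 * k
  ... | yes i<2k = subst (_< n′) (sym (Finₚ.toℕ-fromℕ< _)) (<-≤-trans (partner-< {k} i<2k) 2k≤n′)
  ... | no  i≮2k = ≮⇒≥ i≮2k , i<n′
  InS₀-closed {inj₂ i} (2k≤i , i<n′) with toℕ i <? 2 * k
  ... | yes i<2k = contradiction i<2k (≤⇒≯ 2k≤i)
  ... | no  _    = i<n′

  S₀-closed : IsEdgeSubsetOf S₀ M₀
  S₀-closed x x∈S₀ = ∈S₀⁺ {mate₀ (splitAt n x)}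
    (InS₀-closed (∈S₀⁻ {splitAt n x} (subst (_∈ S₀) (sym (Finₚ.join-splitAt n n x)) x∈S₀)))

  module Forced (M′ : PerfectMatching (H n k)) (agree : ContainedIn S₀ M₀ M′) where

    μ : V → V
    μ a = splitAt n (mate M′ (join n n a))

    μ-adjacent : ∀ a → HRel n k a (μ a)
    μ-adjacent a = subst (λ b → HRel n k b (μ a)) (Finₚ.splitAt-join n n a) (mate-adj M′ (join n n a))

    μ-involutive : ∀ a → μ (μ a) ≡ a
    μ-involutive a = begin
      splitAt n (mate M′ (join n n (splitAt n (mate M′ (join n n a)))))
        ≡⟨ cong (splitAt n ∘ mate M′) (Finₚ.join-splitAt n n _) ⟩
      splitAt n (mate M′ (mate M′ (join n n a)))  ≡⟨ cong (splitAt n) (mate-invol M′ _) ⟩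
      splitAt n (join n n a)                      ≡⟨ Finₚ.splitAt-join n n a ⟩
      a                                           ∎
      where open ≡-Reasoning

    μ-agrees : ∀ {a} → InS₀ a → μ a ≡ mate₀ a
    μ-agrees {a} a∈S₀ = begin
      splitAt n (mate M′ (join n n a))                      ≡⟨ cong (splitAt n) (agree _ (∈S₀⁺ a∈S₀)) ⟩
      splitAt n (join n n (mate₀ (splitAt n (join n n a)))) ≡⟨ Finₚ.splitAt-join n n _ ⟩
      mate₀ (splitAt n (join n n a))                        ≡⟨ cong mate₀ (Finₚ.splitAt-join n n a) ⟩
      mate₀ a                                               ∎
      where open ≡-Reasoning

    forced-at : ∀ a → (∀ b → HRel n k a b → μ b ≡ a → InS₀ b ⊎ b ≡ mate₀ a) → μ a ≡ mate₀ a
    forced-at a candidates with candidates (μ a) (μ-adjacent a) (μ-involutive a)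
    ... | inj₂ μa≡ = μa≡
    ... | inj₁ μa∈S₀ = begin
      μ a                  ≡⟨ mate₀-involutive (μ a) ⟨
      mate₀ (mate₀ (μ a))  ≡⟨ cong mate₀ (μ-agrees μa∈S₀) ⟨
      mate₀ (μ (μ a))      ≡⟨ cong mate₀ (μ-involutive a) ⟩
      mate₀ a              ∎
      where open ≡-Reasoning

    last : Fin n
    last = Fin.fromℕ n′

    toℕ-last : toℕ last ≡ n′
    toℕ-last = Finₚ.toℕ-fromℕ n′

    last-high : toℕ last ≮ 2 * k
    last-high = ≤⇒≯ (subst (2 * k ≤_) (sym toℕ-last) 2k≤n′)

    ≮n′⇒last : ∀ {i : Fin n} → toℕ i ≮ n′ → i ≡ last
    ≮n′⇒last {i} i≮n′ =
      Finₚ.toℕ-injective (trans (≤-antisym (s≤s⁻¹ (Finₚ.toℕ<n i)) (≮⇒≥ i≮n′)) (sym toℕ-last))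

    mate₀-v-last : mate₀ (inj₂ last) ≡ inj₁ last
    mate₀-v-last with mate₀-view (inj₂ last)
    ... | same-side last<2k _ _ = contradiction last<2k last-high
    ... | swapped _ eq          = eq

    mate₀-u-last : mate₀ (inj₁ last) ≡ inj₂ last
    mate₀-u-last = trans (cong mate₀ (sym mate₀-v-last)) (mate₀-involutive (inj₂ last))

    μ-v-last : μ (inj₂ last) ≡ mate₀ (inj₂ last)
    μ-v-last = forced-at (inj₂ last) candidates
      where
      candidates : ∀ b → HRel n k (inj₂ last) b → μ b ≡ inj₂ last → InS₀ b ⊎ b ≡ mate₀ (inj₂ last)
      candidates (inj₂ j) paired _ = contradiction (Partners.below (Paired⇒Partners paired)) last-high
      candidates (inj₁ j) _      _ with toℕ j <? n′
      ... | yes j<n′ = inj₁ j<n′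
      ... | no  j≮n′ = inj₂ (trans (cong inj₁ (≮n′⇒last j≮n′)) (sym mate₀-v-last))

    μ-u-last : μ (inj₁ last) ≡ mate₀ (inj₁ last)
    μ-u-last = begin
      μ (inj₁ last)            ≡⟨ cong μ (trans (sym mate₀-v-last) (sym μ-v-last)) ⟩
      μ (μ (inj₂ last))        ≡⟨ μ-involutive (inj₂ last) ⟩
      inj₂ last                ≡⟨ mate₀-u-last ⟨
      mate₀ (inj₁ last)        ∎
      where open ≡-Reasoning

    μ-v-low : ∀ {i} → toℕ i < 2 * k → μ (inj₂ i) ≡ mate₀ (inj₂ i)
    μ-v-low {i} i<2k = forced-at (inj₂ i) candidates
      where
      candidates : ∀ b → HRel n k (inj₂ i) b → μ b ≡ inj₂ i → InS₀ b ⊎ b ≡ mate₀ (inj₂ i)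
      candidates (inj₂ j) paired _ with mate₀-view (inj₂ i)
      ... | same-side _ side≡ index≡ = inj₂ (side-index-injective (sym side≡)
                                         (trans (sym (Partners.partner-of (Paired⇒Partners paired))) (sym index≡)))
      ... | swapped i≮2k _ = contradiction i<2k i≮2k
      candidates (inj₁ j) _ μj≡vi with toℕ j <? n′
      ... | yes j<n′ = inj₁ j<n′
      ... | no  j≮n′ = contradiction (begin
              toℕ i                  ≡⟨ cong index μj≡vi ⟨
              index (μ (inj₁ j))     ≡⟨ cong (index ∘ μ ∘ inj₁) (≮n′⇒last j≮n′) ⟩
              index (μ (inj₁ last))  ≡⟨ cong index (trans μ-u-last mate₀-u-last) ⟩
              toℕ last               ≡⟨ toℕ-last ⟩
              n′                     ∎) (<⇒≢ (<-≤-trans i<2k 2k≤n′))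
        where open ≡-Reasoning

    μ≡mate₀ : ∀ a → μ a ≡ mate₀ a
    μ≡mate₀ (inj₁ i) with toℕ i <? n′
    ... | yes i<n′ = μ-agrees i<n′
    ... | no  i≮n′ rewrite ≮n′⇒last i≮n′ = μ-u-last
    μ≡mate₀ (inj₂ i) with 2 * k ≤? toℕ i | toℕ i <? n′
    ... | no  2k≰i | _        = μ-v-low (≰⇒> 2k≰i)
    ... | yes 2k≤i | yes i<n′ = μ-agrees (2k≤i , i<n′)
    ... | yes _    | no  i≮n′ rewrite ≮n′⇒last i≮n′ = μ-v-last

    M′≡M₀ : ∀ x → mate M′ x ≡ mate M₀ x
    M′≡M₀ x = begin
      mate M′ x                         ≡⟨ Finₚ.join-splitAt n n _ ⟨
      join n n (splitAt n (mate M′ x))  ≡⟨ cong (join n n ∘ splitAt n ∘ mate M′) (Finₚ.join-splitAt n n x) ⟨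
      join n n (μ (splitAt n x))        ≡⟨ cong (join n n) (μ≡mate₀ (splitAt n x)) ⟩
      join n n (mate₀ (splitAt n x))    ∎
      where open ≡-Reasoning

  S₀-forcing : IsForcingSet M₀ S₀
  S₀-forcing = S₀-closed , λ M′ agree → Forced.M′≡M₀ M′ agree

k≤n/2⇒2k≤n : ∀ {k n} → k ≤ n / 2 → 2 * k ≤ n
k≤n/2⇒2k≤n {k} {n} k≤n/2 = begin
  2 * k        ≤⟨ *-monoʳ-≤ 2 k≤n/2 ⟩
  2 * (n / 2)  ≡⟨ *-comm 2 (n / 2) ⟩
  n / 2 * 2    ≤⟨ m/n*n≤m n 2 ⟩
  n            ∎
  where open ≤-Reasoning

n+[n∸2k]≡2[1+n∸k∸1] : ∀ n k → 2 * k ≤ n → n + (n ∸ 2 * k) ≡ 2 * (suc n ∸ k ∸ 1)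
n+[n∸2k]≡2[1+n∸k∸1] n k 2k≤n = begin
  n + (n ∸ 2 * k)     ≡⟨ +-∸-assoc n 2k≤n ⟨
  n + n ∸ 2 * k       ≡⟨ cong (λ m → n + m ∸ 2 * k) (+-identityʳ n) ⟨
  2 * n ∸ 2 * k       ≡⟨ *-distribˡ-∸ 2 n k ⟨
  2 * (n ∸ k)         ≡⟨ cong (2 *_) (n∸[1+k]≡n∸k∸1 (suc n) k) ⟩
  2 * (suc n ∸ k ∸ 1) ∎
  where open ≡-Reasoning

lemma5p6 : (n k : ℕ) → 1 ≤ n → k ≤ (n ∸ 1) / 2 → ForcingNumberIs (H n k) (n ∸ k ∸ 1)
lemma5p6 (suc n′) k _ k≤n′/2 =
  (M₀ , S₀ , S₀-forcing , trans ∣S₀∣ (n+[n∸2k]≡2[1+n∸k∸1] n′ k 2k≤n′)) , forcing-set-lower-bound (suc n′) k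
  where
  2k≤n′ : 2 * k ≤ n′
  2k≤n′ = k≤n/2⇒2k≤n k≤n′/2
  open UpperBound n′ k 2k≤n′
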